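{- Let $r\in\mathbb{Z}$ and $\ell\geqslant 0$ be integers with $r\notin\{0,-2,-4,\ldots,-2\ell\}$, and let $\mathsf{d}_{r,\ell}=(1-q^rz)(1-q^{r+2}z)\cdots(1-q^{r+2\ell}z)$. Then there exist non-zero polynomials $p_{r,\ell,i}\in\mathbb{Z}[z,q,q^{ -1}]$, $0\leqslant i\leqslant \ell$, such that \[ \sum_{i=0}^{\ell}p_{r,\ell,i}\,\frac{\mathsf{d}_{r,\ell}}{1-q^{r+2i}z}=(1-z^2)(1-z^4)\cdots(1-z^{2\ell}). \] -}

module Defs where

open import Data.Nat as ℕ using (ℕ; zero; suc)
open import Data.Integer as ℤ using (ℤ; +_; -_; 0ℤ; 1ℤ; -1ℤ)
open import Data.List using (List; []; _∷_; _++_; map; concatMap; foldr; upTo; filter; allFin)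
open import Data.Fin using (Fin; toℕ)
open import Data.Product using (Σ; ∃; _,_)
open import Relation.Nullary using (¬_; yes; no; ¬?)
open import Relation.Binary.PropositionalEquality using (_≡_; _≢_)

-- Laurent polynomials in ℤ[z, q, q⁻¹], represented as formal finite sums of
-- monomials  c · z^a · q^b  (a : ℕ, b : ℤ).  Two representations denote the
-- same element iff all their coefficients agree (see _≈P_).

record Term : Set where
  constructor mon
  field
    coef : ℤ
    zexp : ℕ
    qexp : ℤ
open Term public

Poly : Set
Poly = List Term

0P : Poly
0P = []

1P : Poly
1P = mon 1ℤ 0 0ℤ ∷ []

_⊕_ : Poly → Poly → Poly
_⊕_ = _++_

infixl 6 _⊕_
infixl 7 _⊗_

mulT : Term → Term → Term
mulT (mon c a b) (mon c' a' b') = mon (c ℤ.* c') (a ℕ.+ a') (b ℤ.+ b')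

_⊗_ : Poly → Poly → Poly
p ⊗ r = concatMap (λ s → map (mulT s) r) p

coeff : Poly → ℕ → ℤ → ℤ
coeff [] a b = 0ℤ
coeff (mon c a' b' ∷ p) a b with a' ℕ.≟ a | b' ℤ.≟ b
... | yes _ | yes _ = c ℤ.+ coeff p a b
... | _     | _     = coeff p a b

_≈P_ : Poly → Poly → Set
p ≈P r = ∀ (a : ℕ) (b : ℤ) → coeff p a b ≡ coeff r a b

infix 4 _≈P_

NonZeroP : Poly → Set
NonZeroP p = Σ ℕ λ a → Σ ℤ λ b → coeff p a b ≢ 0ℤ

prodP : List Poly → Poly
prodP = foldr _⊗_ 1P

sumP : List Poly → Poly
sumP = foldr _⊕_ 0P

oneMinusQZ : ℤ → Poly
oneMinusQZ e = mon 1ℤ 0 0ℤ ∷ mon -1ℤ 1 e ∷ []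

oneMinusZ : ℕ → Poly
oneMinusZ k = mon 1ℤ 0 0ℤ ∷ mon -1ℤ k 0ℤ ∷ []

d : ℤ → ℕ → Poly
d r ℓ = prodP (map (λ j → oneMinusQZ (r ℤ.+ + (2 ℕ.* j))) (upTo (suc ℓ)))

-- d_{r,ℓ} / (1 - q^{r+2i} z) = ∏_{0 ≤ j ≤ ℓ, j ≠ i} (1 - q^{r+2j} z)
dDiv : ℤ → ℕ → ℕ → Poly
dDiv r ℓ i = prodP (map (λ j → oneMinusQZ (r ℤ.+ + (2 ℕ.* j)))
                        (filter (λ j → ¬? (j ℕ.≟ i)) (upTo (suc ℓ))))

rhs : ℕ → Poly
rhs ℓ = prodP (map (λ k → oneMinusZ (2 ℕ.* suc k)) (upTo ℓ))

lhs : ℤ → (ℓ : ℕ) → (Fin (suc ℓ) → Poly) → Poly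
lhs r ℓ p = sumP (map (λ i → p i ⊗ dDiv r ℓ (toℕ i)) (allFin (suc ℓ)))

{-# OPTIONS --safe #-}
-- Induction on ℓ, simultaneously for all r.  Write L_j = 1 - q^(r+2j) z and D_i = d_{r,ℓ} / L_i.
-- Removing D_0 from D_0, …, D_ℓ leaves L_0 times the D's of (r + 2, ℓ - 1), and removing D_ℓ
-- leaves L_ℓ times the D's of (r, ℓ - 1); so by induction the ideal ⟨D_0, …, D_ℓ⟩ contains
-- L_0 R and L_ℓ R, where R = (1 - z²)⋯(1 - z^(2ℓ-2)).  Modulo ⟨L_ℓ, L_0⟩ both q^r z and
-- q^(2ℓ) q^r z are ≡ 1, hence q^(2ℓ) ≡ 1 and then z^(2ℓ) ≡ 1; so 1 - z^(2ℓ) ∈ ⟨L_ℓ, L_0⟩ and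
-- (1 - z^(2ℓ)) R ∈ ⟨D_0, …, D_ℓ⟩.
-- As c z^N L_i D_i = c z^N d_{r,ℓ}, adding c_i z^N L_i to the i-th coefficient, for nonzero
-- integers c_i with sum 0 and N above every z-degree, makes all coefficients nonzero.
module Submission where

open import Algebra.Bundles using (CommutativeRing)
open import Data.Fin using (zero; suc; punchIn)
open import Data.Nat using (ℕ; zero; suc)
open import Data.Vec.Functional using (Vector; insertAt; removeAt)
open import Data.Vec.Functional.Properties using (insertAt-lookup; insertAt-punchIn)
open import Function using (_∘_)
open import Level using (_⊔_)

module IdealMembership {c ℓ} (R : CommutativeRing c ℓ) where

  open CommutativeRing R hiding (zero)
  open import Algebra.Properties.Ring ring using (-‿distribˡ-*; x[y-z]≈xy-xz)
  open import Algebra.Properties.AbelianGroup +-abelianGroup using (⁻¹-anti-homo‿-)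
  open import Algebra.Properties.CommutativeSemigroup *-commutativeSemigroup using (x∙yz≈y∙xz)
  open import Algebra.Properties.Semiring.Sum semiring
    using (sum; sum-syntax; sum-cong-≋; sum-remove; sum-replicate-zero; ∑-distrib-+; *-distribˡ-sum; *-distribʳ-sum)
  open import Algebra.Properties.Semiring.Exp semiring using (_^_)
  open import Relation.Binary.Reasoning.Setoid setoid

  private
    variable
      f f′ x y : Carrier

  infix 4 _∈⟨_⟩ _≡1-mod⟨_⟩

  record _∈⟨_⟩ {n} (f : Carrier) (g : Vector Carrier n) : Set (c ⊔ ℓ) where
    constructor combination
    field
      coefficients : Vector Carrier n
      combines     : ∑[ i < n ] (coefficients i * g i) ≈ f

  module _ {n} {g : Vector Carrier n} where

    ∈⟨⟩-resp-≈ : f ≈ f′ → f ∈⟨ g ⟩ → f′ ∈⟨ g ⟩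
    ∈⟨⟩-resp-≈ f≈f′ (combination a Σag≈f) = combination a (trans Σag≈f f≈f′)

    0∈⟨⟩ : 0# ∈⟨ g ⟩
    0∈⟨⟩ = combination (λ _ → 0#) (trans (sum-cong-≋ (λ i → zeroˡ (g i))) (sum-replicate-zero n))

    ∈⟨⟩-+ : f ∈⟨ g ⟩ → f′ ∈⟨ g ⟩ → f + f′ ∈⟨ g ⟩
    ∈⟨⟩-+ (combination a Σag≈f) (combination b Σbg≈f′) = combination (λ i → a i + b i) (begin
      ∑[ i < n ] ((a i + b i) * g i)                   ≈⟨ sum-cong-≋ (λ i → distribʳ (g i) (a i) (b i)) ⟩
      ∑[ i < n ] (a i * g i + b i * g i)               ≈⟨ ∑-distrib-+ (λ i → a i * g i) (λ i → b i * g i) ⟩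
      ∑[ i < n ] (a i * g i) + ∑[ i < n ] (b i * g i)  ≈⟨ +-cong Σag≈f Σbg≈f′ ⟩
      _                                                ∎)

    ∈⟨⟩-*ˡ : ∀ x → f ∈⟨ g ⟩ → x * f ∈⟨ g ⟩
    ∈⟨⟩-*ˡ x (combination a Σag≈f) = combination (λ i → x * a i) (begin
      ∑[ i < n ] (x * a i * g i)    ≈⟨ sum-cong-≋ (λ i → *-assoc x (a i) (g i)) ⟩
      ∑[ i < n ] (x * (a i * g i))  ≈⟨ *-distribˡ-sum x (λ i → a i * g i) ⟨
      x * ∑[ i < n ] (a i * g i)    ≈⟨ *-congˡ Σag≈f ⟩
      _                             ∎)

    ∈⟨⟩-sum : ∀ {m} {t : Vector Carrier m} → (∀ j → t j ∈⟨ g ⟩) → sum t ∈⟨ g ⟩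
    ∈⟨⟩-sum {zero}  t∈ = 0∈⟨⟩
    ∈⟨⟩-sum {suc m} t∈ = ∈⟨⟩-+ (t∈ zero) (∈⟨⟩-sum (t∈ ∘ suc))

  ∈⟨⟩-generator : ∀ {n} {g : Vector Carrier n} i → g i ∈⟨ g ⟩
  ∈⟨⟩-generator {suc n} {g} i = combination δ (begin
    ∑[ j < suc n ] (δ j * g j)                                  ≈⟨ sum-remove {i = i} (λ j → δ j * g j) ⟩
    δ i * g i + ∑[ j < n ] (δ (punchIn i j) * g (punchIn i j))  ≈⟨ +-cong (*-congʳ (reflexive δᵢ≡1)) others ⟩
    1# * g i + 0#                                               ≈⟨ +-identityʳ _ ⟩
    1# * g i                                                    ≈⟨ *-identityˡ (g i) ⟩
    g i                                                         ∎)
    where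
    δ = insertAt (λ _ → 0#) i 1#
    δᵢ≡1 = insertAt-lookup (λ _ → 0#) i 1#
    others : ∑[ j < n ] (δ (punchIn i j) * g (punchIn i j)) ≈ 0#
    others = trans (sum-cong-≋ λ j → trans (*-congʳ (reflexive (insertAt-punchIn _ i 1# j))) (zeroˡ _))
                   (sum-replicate-zero n)

  ∈⟨⟩-removeAt : ∀ {n} {g : Vector Carrier (suc n)} i → f ∈⟨ removeAt g i ⟩ → f ∈⟨ g ⟩
  ∈⟨⟩-removeAt {f = f} {n} {g} i (combination a Σag≈f) = combination a′ (begin
    ∑[ j < suc n ] (a′ j * g j)                                   ≈⟨ sum-remove {i = i} (λ j → a′ j * g j) ⟩
    a′ i * g i + ∑[ j < n ] (a′ (punchIn i j) * g (punchIn i j))  ≈⟨ +-cong removed others ⟩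
    0# + ∑[ j < n ] (a j * g (punchIn i j))                       ≈⟨ +-identityˡ _ ⟩
    ∑[ j < n ] (a j * g (punchIn i j))                            ≈⟨ Σag≈f ⟩
    f                                                             ∎)
    where
    a′ = insertAt a i 0#
    removed : a′ i * g i ≈ 0#
    removed = trans (*-congʳ (reflexive (insertAt-lookup a i 0#))) (zeroˡ (g i))
    others : ∑[ j < n ] (a′ (punchIn i j) * g (punchIn i j)) ≈ ∑[ j < n ] (a j * g (punchIn i j))
    others = sum-cong-≋ λ j → *-congʳ (reflexive (insertAt-punchIn a i 0# j))

  ∈⟨⟩-scale : ∀ {n} {g h : Vector Carrier n} {t} → (∀ j → g j ≈ t * h j) → f ∈⟨ h ⟩ → t * f ∈⟨ g ⟩
  ∈⟨⟩-scale {f = f} {n} {g} {h} {t} g≈th (combination a Σah≈f) = combination a (begin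
    ∑[ j < n ] (a j * g j)        ≈⟨ sum-cong-≋ (λ j → trans (*-congˡ (g≈th j)) (x∙yz≈y∙xz (a j) t (h j))) ⟩
    ∑[ j < n ] (t * (a j * h j))  ≈⟨ *-distribˡ-sum t (λ j → a j * h j) ⟨
    t * ∑[ j < n ] (a j * h j)    ≈⟨ *-congˡ Σah≈f ⟩
    t * f                         ∎)

  ∈⟨⟩-*-generators : ∀ {m n} {h : Vector Carrier m} {g : Vector Carrier n} →
                     f ∈⟨ h ⟩ → (∀ j → h j * x ∈⟨ g ⟩) → f * x ∈⟨ g ⟩
  ∈⟨⟩-*-generators {f = f} {x = x} {m} {h = h} (combination a Σah≈f) hx∈g =
    ∈⟨⟩-resp-≈ (begin
      ∑[ j < m ] (a j * (h j * x))  ≈⟨ sum-cong-≋ (λ j → *-assoc (a j) (h j) x) ⟨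
      ∑[ j < m ] (a j * h j * x)    ≈⟨ *-distribʳ-sum x (λ j → a j * h j) ⟨
      ∑[ j < m ] (a j * h j) * x    ≈⟨ *-congʳ Σah≈f ⟩
      f * x                         ∎)
    (∈⟨⟩-sum (λ j → ∈⟨⟩-*ˡ (a j) (hx∈g j)))

  -- A record rather than a synonym for 1# - x ∈⟨ g ⟩, so that x can be inferred.
  record _≡1-mod⟨_⟩ {n} (x : Carrier) (g : Vector Carrier n) : Set (c ⊔ ℓ) where
    constructor ≡1-mod
    field 1-x∈⟨⟩ : 1# - x ∈⟨ g ⟩

  open _∈⟨_⟩ public
  open _≡1-mod⟨_⟩ public

  -‿telescope : ∀ x y z → (x - y) + (y - z) ≈ x - z
  -‿telescope x y z = begin
    (x - y) + (y - z)    ≈⟨ +-assoc x (- y) (y - z) ⟩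
    x + (- y + (y - z))  ≈⟨ +-congˡ (+-assoc (- y) y (- z)) ⟨
    x + ((- y + y) - z)  ≈⟨ +-congˡ (+-congʳ (-‿inverseˡ y)) ⟩
    x + (0# - z)         ≈⟨ +-congˡ (+-identityˡ (- z)) ⟩
    x - z                ∎

  module _ {n} {g : Vector Carrier n} where

    ≡1-mod-resp-≈ : x ≈ y → x ≡1-mod⟨ g ⟩ → y ≡1-mod⟨ g ⟩
    ≡1-mod-resp-≈ x≈y (≡1-mod 1-x∈) = ≡1-mod (∈⟨⟩-resp-≈ (+-congˡ (-‿cong x≈y)) 1-x∈)

    ≡1-mod-* : x ≡1-mod⟨ g ⟩ → y ≡1-mod⟨ g ⟩ → x * y ≡1-mod⟨ g ⟩
    ≡1-mod-* {x} {y} (≡1-mod 1-x∈) (≡1-mod 1-y∈) = ≡1-mod (∈⟨⟩-resp-≈ (begin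
      (1# - x) + x * (1# - y)      ≈⟨ +-congˡ (x[y-z]≈xy-xz x 1# y) ⟩
      (1# - x) + (x * 1# - x * y)  ≈⟨ +-congˡ (+-congʳ (*-identityʳ x)) ⟩
      (1# - x) + (x - x * y)       ≈⟨ -‿telescope 1# x (x * y) ⟩
      1# - x * y                   ∎)
      (∈⟨⟩-+ 1-x∈ (∈⟨⟩-*ˡ x 1-y∈)))

    ≡1-mod-cancelʳ : x * y ≡1-mod⟨ g ⟩ → y ≡1-mod⟨ g ⟩ → x ≡1-mod⟨ g ⟩
    ≡1-mod-cancelʳ {x} {y} (≡1-mod 1-xy∈) (≡1-mod 1-y∈) = ≡1-mod (∈⟨⟩-resp-≈ (begin
      (1# - x * y) + - x * (1# - y)    ≈⟨ +-congˡ (-‿distribˡ-* x (1# - y)) ⟨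
      (1# - x * y) - x * (1# - y)      ≈⟨ +-congˡ (-‿cong (x[y-z]≈xy-xz x 1# y)) ⟩
      (1# - x * y) - (x * 1# - x * y)  ≈⟨ +-congˡ (⁻¹-anti-homo‿- (x * 1#) (x * y)) ⟩
      (1# - x * y) + (x * y - x * 1#)  ≈⟨ +-congˡ (+-congˡ (-‿cong (*-identityʳ x))) ⟩
      (1# - x * y) + (x * y - x)       ≈⟨ -‿telescope 1# (x * y) x ⟩
      1# - x                           ∎)
      (∈⟨⟩-+ 1-xy∈ (∈⟨⟩-*ˡ (- x) 1-y∈)))

    ≡1-mod-^ : x ≡1-mod⟨ g ⟩ → ∀ k → x ^ k ≡1-mod⟨ g ⟩
    ≡1-mod-^ x≡1 zero    = ≡1-mod (∈⟨⟩-resp-≈ (sym (-‿inverseʳ 1#)) 0∈⟨⟩)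
    ≡1-mod-^ x≡1 (suc k) = ≡1-mod-* x≡1 (≡1-mod-^ x≡1 k)

open import Defs
import Algebra.Consequences.Setoid as Consequences
open import Data.Empty using (⊥-elim)
open import Data.Fin using (Fin; toℕ; fromℕ; inject₁)
import Data.Fin.Properties as FinP
open import Data.Integer as ℤ using (ℤ; +_; -_; -[1+_]; 0ℤ; 1ℤ; -1ℤ)
  renaming (_+_ to _+ᶻ_; _*_ to _*ᶻ_; _-_ to _-ᶻ_)
import Data.Integer.Properties as ℤP
open import Data.Integer.Tactic.RingSolver using (solve-∀)
open import Data.List using ([]; _∷_; [_]; _++_; map; foldr; filter; upTo; tabulate)
import Data.List.Properties as ListP
open import Data.Nat as ℕ using (_*_; _≤_; s≤s)
import Data.Nat.Properties as ℕP
open import Data.Nat.Tactic.RingSolver using () renaming (solve-∀ to ℕ-solve-∀)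
open import Data.Product using (Σ; _×_; _,_)
import Data.Vec.Functional as Vector
open import Function using (id)
open import Level using (0ℓ)
open import Relation.Binary.Bundles using (Setoid)
open import Relation.Binary.Structures using (IsEquivalence)
open import Relation.Binary.PropositionalEquality as ≡ using (_≡_; _≢_; refl; cong; cong₂)
open import Relation.Nullary using (¬_; yes; no; ¬?; _×-dec_)

-- ℤ[z, q, q⁻¹] as a commutative ring

infix 4 _≈_

-- _≈P_ unfolds to a function type, from which Agda cannot infer the two polynomials.
record _≈_ (p r : Poly) : Set where
  constructor mk≈
  field coeff-≡ : p ≈P r

open _≈_

≈-isEquivalence : IsEquivalence _≈_
≈-isEquivalence = record
  { refl  = mk≈ λ _ _ → refl
  ; sym   = λ (mk≈ p≈r) → mk≈ λ a b → ≡.sym (p≈r a b)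
  ; trans = λ (mk≈ p≈r) (mk≈ r≈u) → mk≈ λ a b → ≡.trans (p≈r a b) (r≈u a b)
  }

≈-setoid : Setoid _ _
≈-setoid = record { isEquivalence = ≈-isEquivalence }

open Setoid ≈-setoid using ()
  renaming (refl to ≈-refl; sym to ≈-sym; trans to ≈-trans; reflexive to ≈-reflexive)

coeff-∷ : ∀ t p a b → coeff (t ∷ p) a b ≡ coeff [ t ] a b +ᶻ coeff p a b
coeff-∷ (mon c a′ b′) p a b with a′ ℕ.≟ a | b′ ℤ.≟ b
... | yes _ | yes _ = cong (ℤ._+ coeff p a b) (≡.sym (ℤP.+-identityʳ c))
... | yes _ | no _  = ≡.sym (ℤP.+-identityˡ _)
... | no _  | _     = ≡.sym (ℤP.+-identityˡ _)

coeff-++ : ∀ p r a b → coeff (p ++ r) a b ≡ coeff p a b +ᶻ coeff r a b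
coeff-++ []      r a b = ≡.sym (ℤP.+-identityˡ _)
coeff-++ (t ∷ p) r a b = ≡.trans (coeff-∷ t (p ++ r) a b) (≡.trans (cong (coeff [ t ] a b +ᶻ_) (coeff-++ p r a b))
  (≡.trans (≡.sym (ℤP.+-assoc (coeff [ t ] a b) _ _)) (cong (ℤ._+ coeff r a b) (≡.sym (coeff-∷ t p a b)))))

coeff-mon-here : ∀ c a b → coeff [ mon c a b ] a b ≡ c
coeff-mon-here c a b with a ℕ.≟ a | b ℤ.≟ b
... | yes _ | yes _   = ℤP.+-identityʳ c
... | yes _ | no b≢b  = ⊥-elim (b≢b refl)
... | no a≢a | _      = ⊥-elim (a≢a refl)

coeff-mon-elsewhere : ∀ c {a′ b′ a b} → ¬ (a′ ≡ a × b′ ≡ b) → coeff [ mon c a′ b′ ] a b ≡ 0ℤ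
coeff-mon-elsewhere c {a′} {b′} {a} {b} ≢ with a′ ℕ.≟ a | b′ ℤ.≟ b
... | yes a′≡a | yes b′≡b = ⊥-elim (≢ (a′≡a , b′≡b))
... | yes _    | no _     = refl
... | no _     | _        = refl

coeff-mon-+ : ∀ c c′ a b a′ b′ →
              coeff [ mon c a b ] a′ b′ +ᶻ coeff [ mon c′ a b ] a′ b′ ≡ coeff [ mon (c +ᶻ c′) a b ] a′ b′
coeff-mon-+ c c′ a b a′ b′ with a ℕ.≟ a′ | b ℤ.≟ b′
... | yes _ | yes _ = ≡.trans (cong₂ _+ᶻ_ (ℤP.+-identityʳ c) (ℤP.+-identityʳ c′)) (≡.sym (ℤP.+-identityʳ _))
... | yes _ | no _  = refl
... | no _  | _     = refl

coeff-mon-0 : ∀ a b a′ b′ → coeff [ mon 0ℤ a b ] a′ b′ ≡ 0ℤ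
coeff-mon-0 a b a′ b′ with a ℕ.≟ a′ | b ℤ.≟ b′
... | yes _ | yes _ = refl
... | yes _ | no _  = refl
... | no _  | _     = refl

shiftedCoeff : Poly → ℕ → ℤ → ℕ → ℤ → ℤ
shiftedCoeff p i j a b with i ℕ.≤? a
... | yes _ = coeff p (a ℕ.∸ i) (b -ᶻ j)
... | no _  = 0ℤ

shiftedCoeff-∷ : ∀ t p i j a b →
                 shiftedCoeff (t ∷ p) i j a b ≡ shiftedCoeff [ t ] i j a b +ᶻ shiftedCoeff p i j a b
shiftedCoeff-∷ t p i j a b with i ℕ.≤? a
... | yes _ = coeff-∷ t p (a ℕ.∸ i) (b -ᶻ j)
... | no _  = refl

shiftedCoeff-cong : ∀ {p r} → p ≈ r → ∀ i j a b → shiftedCoeff p i j a b ≡ shiftedCoeff r i j a b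
shiftedCoeff-cong (mk≈ p≈r) i j a b with i ℕ.≤? a
... | yes _ = p≈r (a ℕ.∸ i) (b -ᶻ j)
... | no _  = refl

shiftedCoeff-here : ∀ p i j → shiftedCoeff p i j i j ≡ coeff p 0 0ℤ
shiftedCoeff-here p i j with i ℕ.≤? i
... | yes _   = cong₂ (coeff p) (ℕP.n∸n≡0 i) (ℤP.+-inverseʳ j)
... | no i≰i  = ⊥-elim (i≰i ℕP.≤-refl)

coeff-mulT : ∀ s t a b → coeff [ mulT s t ] a b ≡ coef s *ᶻ shiftedCoeff [ t ] (zexp s) (qexp s) a b
coeff-mulT (mon c i j) (mon c′ i′ j′) a b with i ℕ.≤? a
... | no i≰a =
  ≡.trans (coeff-mon-elsewhere (c *ᶻ c′) λ (i+i′≡a , _) → i≰a (≡.subst (i ≤_) i+i′≡a (ℕP.m≤m+n i i′)))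
          (≡.sym (ℤP.*-zeroʳ c))
... | yes i≤a with (i′ ℕ.≟ a ℕ.∸ i) ×-dec (j′ ℤ.≟ b -ᶻ j)
...   | yes (refl , refl) =
  ≡.trans (cong₂ (λ a″ b″ → coeff [ mon (c *ᶻ c′) a″ b″ ] a b) (ℕP.m+[n∸m]≡n i≤a) (j+[b-j]≡b j b))
    (≡.trans (coeff-mon-here (c *ᶻ c′) a b) (cong (c *ᶻ_) (≡.sym (coeff-mon-here c′ (a ℕ.∸ i) (b -ᶻ j)))))
  where
  j+[b-j]≡b : ∀ j b → j +ᶻ (b -ᶻ j) ≡ b
  j+[b-j]≡b = solve-∀
...   | no ≢ =
  ≡.trans (coeff-mon-elsewhere (c *ᶻ c′) λ (i+i′≡a , j+j′≡b) →
             ≢ ( ≡.trans (≡.sym (ℕP.m+n∸m≡n i i′)) (cong (ℕ._∸ i) i+i′≡a)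
               , ≡.trans (≡.sym ([j+j′]-j≡j′ j j′)) (cong (_-ᶻ j) j+j′≡b)))
    (≡.trans (≡.sym (ℤP.*-zeroʳ c)) (cong (c *ᶻ_) (≡.sym (coeff-mon-elsewhere c′ ≢))))
  where
  [j+j′]-j≡j′ : ∀ j j′ → (j +ᶻ j′) -ᶻ j ≡ j′
  [j+j′]-j≡j′ = solve-∀

coeff-map-mulT : ∀ s p a b → coeff (map (mulT s) p) a b ≡ coef s *ᶻ shiftedCoeff p (zexp s) (qexp s) a b
coeff-map-mulT s []      a b = ≡.sym (≡.trans (cong (coef s *ᶻ_) (shifted-[] (zexp s) (qexp s))) (ℤP.*-zeroʳ (coef s)))
  where
  shifted-[] : ∀ i j → shiftedCoeff [] i j a b ≡ 0ℤ
  shifted-[] i j with i ℕ.≤? a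
  ... | yes _ = refl
  ... | no _  = refl
coeff-map-mulT s (t ∷ p) a b = begin≡
  coeff (mulT s t ∷ map (mulT s) p) a b                     ≡⟨ coeff-∷ (mulT s t) _ a b ⟩
  coeff [ mulT s t ] a b +ᶻ coeff (map (mulT s) p) a b      ≡⟨ cong₂ _+ᶻ_ (coeff-mulT s t a b) (coeff-map-mulT s p a b) ⟩
  coef s *ᶻ shifted [ t ] +ᶻ coef s *ᶻ shifted p             ≡⟨ ℤP.*-distribˡ-+ (coef s) _ _ ⟨
  coef s *ᶻ (shifted [ t ] +ᶻ shifted p)                     ≡⟨ cong (coef s *ᶻ_) (shiftedCoeff-∷ t p (zexp s) (qexp s) a b) ⟨
  coef s *ᶻ shifted (t ∷ p)                                  ∎≡
  where
  open ≡.≡-Reasoning renaming (begin_ to begin≡_; _∎ to _∎≡)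
  shifted : Poly → ℤ
  shifted p = shiftedCoeff p (zexp s) (qexp s) a b

zdeg : Poly → ℕ
zdeg = foldr (λ t → zexp t ℕ.⊔_) 0

coeff-zdeg< : ∀ p {a} b → zdeg p ℕ.< a → coeff p a b ≡ 0ℤ
coeff-zdeg< []                b _      = refl
coeff-zdeg< (mon c a′ b′ ∷ p) b zdeg<a = ≡.trans (coeff-∷ (mon c a′ b′) p _ b)
  (cong₂ _+ᶻ_ (coeff-mon-elsewhere c λ (a′≡a , _) → ℕP.<-irrefl a′≡a (ℕP.≤-<-trans (ℕP.m≤m⊔n a′ (zdeg p)) zdeg<a))
              (coeff-zdeg< p b (ℕP.≤-<-trans (ℕP.m≤n⊔m a′ (zdeg p)) zdeg<a)))

neg : Poly → Poly
neg p = [ mon -1ℤ 0 0ℤ ] ⊗ p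

coeff-neg : ∀ p a b → coeff (neg p) a b ≡ -1ℤ *ᶻ coeff p a b
coeff-neg p a b = ≡.trans (cong (λ l → coeff l a b) (ListP.++-identityʳ (map (mulT (mon -1ℤ 0 0ℤ)) p)))
  (≡.trans (coeff-map-mulT (mon -1ℤ 0 0ℤ) p a b) (cong (λ b′ → -1ℤ *ᶻ coeff p a b′) (ℤP.+-identityʳ b)))

neg-inverseʳ : ∀ p → p ⊕ neg p ≈ 0P
neg-inverseʳ p = mk≈ λ a b →
  ≡.trans (coeff-++ p (neg p) a b) (≡.trans (cong (coeff p a b +ᶻ_) (coeff-neg p a b)) (x-x≡0 (coeff p a b)))
  where
  x-x≡0 : ∀ x → x +ᶻ -1ℤ *ᶻ x ≡ 0ℤ
  x-x≡0 = solve-∀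

open import Relation.Binary.Reasoning.Setoid ≈-setoid

⊕-cong : ∀ {p p′ r r′} → p ≈ p′ → r ≈ r′ → p ⊕ r ≈ p′ ⊕ r′
⊕-cong {p} {p′} {r} {r′} (mk≈ p≈p′) (mk≈ r≈r′) = mk≈ λ a b →
  ≡.trans (coeff-++ p r a b) (≡.trans (cong₂ _+ᶻ_ (p≈p′ a b) (r≈r′ a b)) (≡.sym (coeff-++ p′ r′ a b)))

⊕-comm : ∀ p r → p ⊕ r ≈ r ⊕ p
⊕-comm p r = mk≈ λ a b →
  ≡.trans (coeff-++ p r a b) (≡.trans (ℤP.+-comm (coeff p a b) (coeff r a b)) (≡.sym (coeff-++ r p a b)))

⊕-assoc : ∀ p r u → (p ⊕ r) ⊕ u ≈ p ⊕ (r ⊕ u)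
⊕-assoc p r u = ≈-reflexive (ListP.++-assoc p r u)

⊕-identityʳ : ∀ p → p ⊕ 0P ≈ p
⊕-identityʳ p = ≈-reflexive (ListP.++-identityʳ p)

map-mulT-congʳ : ∀ s {r r′} → r ≈ r′ → map (mulT s) r ≈ map (mulT s) r′
map-mulT-congʳ s {r} {r′} r≈r′ = mk≈ λ a b → ≡.trans (coeff-map-mulT s r a b)
  (≡.trans (cong (coef s *ᶻ_) (shiftedCoeff-cong r≈r′ (zexp s) (qexp s) a b)) (≡.sym (coeff-map-mulT s r′ a b)))

⊗-congʳ : ∀ p {r r′} → r ≈ r′ → p ⊗ r ≈ p ⊗ r′
⊗-congʳ []      r≈r′ = ≈-refl
⊗-congʳ (s ∷ p) r≈r′ = ⊕-cong (map-mulT-congʳ s r≈r′) (⊗-congʳ p r≈r′)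

⊗-distribʳ : ∀ u p r → (p ⊕ r) ⊗ u ≈ p ⊗ u ⊕ r ⊗ u
⊗-distribʳ u p r = ≈-reflexive (ListP.concatMap-++ (λ s → map (mulT s) u) p r)

⊗-zeroʳ : ∀ p → p ⊗ 0P ≈ 0P
⊗-zeroʳ []      = ≈-refl
⊗-zeroʳ (s ∷ p) = ⊗-zeroʳ p

mulT-comm : ∀ s t → mulT s t ≡ mulT t s
mulT-comm (mon c a b) (mon c′ a′ b′) =
  ≡.cong₂ (λ x (a , b) → mon x a b) (ℤP.*-comm c c′) (cong₂ _,_ (ℕP.+-comm a a′) (ℤP.+-comm b b′))

mulT-assoc : ∀ s t u → mulT (mulT s t) u ≡ mulT s (mulT t u)
mulT-assoc (mon c a b) (mon c′ a′ b′) (mon c″ a″ b″) =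
  ≡.cong₂ (λ x (a , b) → mon x a b) (ℤP.*-assoc c c′ c″) (cong₂ _,_ (ℕP.+-assoc a a′ a″) (ℤP.+-assoc b b′ b″))

⊗-∷ʳ : ∀ p s r → p ⊗ (s ∷ r) ≈ map (λ t → mulT t s) p ⊕ p ⊗ r
⊗-∷ʳ []      s r = ≈-refl
⊗-∷ʳ (t ∷ p) s r = ⊕-cong (≈-refl {[ mulT t s ]}) (begin
  map (mulT t) r ⊕ p ⊗ (s ∷ r)          ≈⟨ ⊕-cong (≈-refl {map (mulT t) r}) (⊗-∷ʳ p s r) ⟩
  map (mulT t) r ⊕ (ps ⊕ p ⊗ r)         ≈⟨ ⊕-assoc (map (mulT t) r) ps (p ⊗ r) ⟨
  (map (mulT t) r ⊕ ps) ⊕ p ⊗ r         ≈⟨ ⊕-cong (⊕-comm (map (mulT t) r) ps) (≈-refl {p ⊗ r}) ⟩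
  (ps ⊕ map (mulT t) r) ⊕ p ⊗ r         ≈⟨ ⊕-assoc ps (map (mulT t) r) (p ⊗ r) ⟩
  ps ⊕ (map (mulT t) r ⊕ p ⊗ r)         ∎)
  where ps = map (λ t → mulT t s) p

⊗-comm : ∀ p r → p ⊗ r ≈ r ⊗ p
⊗-comm []      r = ≈-sym (⊗-zeroʳ r)
⊗-comm (s ∷ p) r = begin
  map (mulT s) r ⊕ p ⊗ r                  ≈⟨ ⊕-cong (≈-reflexive (ListP.map-cong (mulT-comm s) r)) (⊗-comm p r) ⟩
  map (λ t → mulT t s) r ⊕ r ⊗ p          ≈⟨ ⊗-∷ʳ r s p ⟨
  r ⊗ (s ∷ p)                             ∎

map-mulT-⊗ : ∀ s r u → map (mulT s) r ⊗ u ≡ map (mulT s) (r ⊗ u)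
map-mulT-⊗ s []      u = refl
map-mulT-⊗ s (t ∷ r) u = ≡.trans
  (cong₂ _++_ (≡.trans (ListP.map-cong (mulT-assoc s t) u) (ListP.map-∘ u)) (map-mulT-⊗ s r u))
  (≡.sym (ListP.map-++ (mulT s) (map (mulT t) u) (r ⊗ u)))

⊗-assoc : ∀ p r u → (p ⊗ r) ⊗ u ≈ p ⊗ (r ⊗ u)
⊗-assoc []      r u = ≈-refl
⊗-assoc (s ∷ p) r u = begin
  (map (mulT s) r ⊕ p ⊗ r) ⊗ u          ≈⟨ ⊗-distribʳ u (map (mulT s) r) (p ⊗ r) ⟩
  map (mulT s) r ⊗ u ⊕ (p ⊗ r) ⊗ u      ≈⟨ ⊕-cong (≈-reflexive (map-mulT-⊗ s r u)) (⊗-assoc p r u) ⟩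
  map (mulT s) (r ⊗ u) ⊕ p ⊗ (r ⊗ u)    ∎

⊗-identityˡ : ∀ p → 1P ⊗ p ≈ p
⊗-identityˡ p = ≈-reflexive (≡.trans (ListP.++-identityʳ _) (≡.trans (ListP.map-cong mulT-1 p) (ListP.map-id p)))
  where
  mulT-1 : ∀ t → mulT (mon 1ℤ 0 0ℤ) t ≡ t
  mulT-1 (mon c a b) = cong₂ (λ c b → mon c a b) (ℤP.*-identityˡ c) (ℤP.+-identityˡ b)

⊗-cong : ∀ {p p′ r r′} → p ≈ p′ → r ≈ r′ → p ⊗ r ≈ p′ ⊗ r′
⊗-cong {p} {p′} {r} {r′} p≈p′ r≈r′ = begin
  p ⊗ r    ≈⟨ ⊗-comm p r ⟩
  r ⊗ p    ≈⟨ ⊗-congʳ r p≈p′ ⟩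
  r ⊗ p′   ≈⟨ ⊗-comm r p′ ⟩
  p′ ⊗ r   ≈⟨ ⊗-congʳ p′ r≈r′ ⟩
  p′ ⊗ r′  ∎

Poly-commutativeRing : CommutativeRing 0ℓ 0ℓ
Poly-commutativeRing = record
  { Carrier           = Poly
  ; _≈_               = _≈_
  ; _+_               = _⊕_
  ; _*_               = _⊗_
  ; -_                = neg
  ; 0#                = 0P
  ; 1#                = 1P
  ; isCommutativeRing = record
    { isRing = record
      { +-isAbelianGroup = record
        { isGroup = record
          { isMonoid = record
            { isSemigroup = record
              { isMagma = record { isEquivalence = ≈-isEquivalence ; ∙-cong = ⊕-cong }
              ; assoc   = ⊕-assoc
              }
            ; identity = (λ _ → ≈-refl) , ⊕-identityʳ
            }
          ; inverse = comm∧invʳ⇒inv ⊕-comm neg-inverseʳ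
          ; ⁻¹-cong = ⊗-congʳ [ mon -1ℤ 0 0ℤ ]
          }
        ; comm = ⊕-comm
        }
      ; *-cong     = ⊗-cong
      ; *-assoc    = ⊗-assoc
      ; *-identity = comm∧idˡ⇒id ⊗-comm ⊗-identityˡ
      ; distrib    = comm∧distrʳ⇒distr ⊕-cong ⊗-comm ⊗-distribʳ
      }
    ; *-comm = ⊗-comm
    }
  }
  where open Consequences ≈-setoid

open IdealMembership Poly-commutativeRing
open CommutativeRing Poly-commutativeRing using (semiring; *-identityʳ; *-commutativeSemigroup)
open import Algebra.Properties.CommutativeSemigroup *-commutativeSemigroup using (x∙yz≈y∙xz)
open import Algebra.Properties.Semiring.Exp semiring using (_^_)
open import Algebra.Properties.Semiring.Sum semiring using (sum; sum-cong-≋; *-distribʳ-sum)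

-- Monomials, and 1 - z^n modulo ⟨1 - q^(e+n) z, 1 - q^e z⟩

X : ℕ → ℤ → Poly
X a b = [ mon 1ℤ a b ]

X-≡ : ∀ {a a′ b b′} → a ≡ a′ → b ≡ b′ → X a b ≈ X a′ b′
X-≡ a≡a′ b≡b′ = ≈-reflexive (cong₂ X a≡a′ b≡b′)

X-^ : ∀ a b k → X a b ^ k ≈ X (k * a) (+ k *ᶻ b)
X-^ a b zero    = ≈-refl
X-^ a b (suc k) = begin
  X a b ⊗ X a b ^ k                ≈⟨ ⊗-congʳ (X a b) (X-^ a b k) ⟩
  X (a ℕ.+ k * a) (b +ᶻ + k *ᶻ b)  ≈⟨ X-≡ refl (≡.sym (ℤP.suc-* (+ k) b)) ⟩
  X (suc k * a) (+ suc k *ᶻ b)     ∎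

neg-X : ∀ a b → neg (X a b) ≈ [ mon -1ℤ a b ]
neg-X a b = ≈-reflexive (≡.trans (ListP.++-identityʳ _) (cong (λ b → [ mon -1ℤ a b ]) (ℤP.+-identityˡ b)))

mon-+ : ∀ c c′ a b → [ mon c a b ] ⊕ [ mon c′ a b ] ≈ [ mon (c +ᶻ c′) a b ]
mon-+ c c′ a b = mk≈ λ a′ b′ → ≡.trans (coeff-∷ (mon c a b) [ mon c′ a b ] a′ b′)
  (coeff-mon-+ c c′ a b a′ b′)

mon-0 : ∀ a b → [ mon 0ℤ a b ] ≈ 0P
mon-0 a b = mk≈ (coeff-mon-0 a b)

oneMinusQZ≈ : ∀ e → oneMinusQZ e ≈ 1P ⊕ neg (X 1 e)
oneMinusQZ≈ e = ⊕-cong (≈-refl {1P}) (≈-sym (neg-X 1 e))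

oneMinusZ≈ : ∀ k → oneMinusZ k ≈ 1P ⊕ neg (X k 0ℤ)
oneMinusZ≈ k = ⊕-cong (≈-refl {1P}) (≈-sym (neg-X k 0ℤ))

-- z^n is x^n y^(-e) for x = q^e z and y = q^n; the sign of e decides on which side y^|e| goes.
zⁿ≡1-mod : ∀ {m} {g : Vector.Vector Poly m} e n →
           X 1 e ≡1-mod⟨ g ⟩ → X 0 (+ n) ≡1-mod⟨ g ⟩ → X n 0ℤ ≡1-mod⟨ g ⟩
zⁿ≡1-mod (+ k) n x≡1 y≡1 = ≡1-mod-cancelʳ (≡1-mod-resp-≈ xⁿ≈zⁿyᵏ (≡1-mod-^ x≡1 n)) (≡1-mod-^ y≡1 k)
  where
  z-exponent : ∀ n k → n * 1 ≡ n ℕ.+ k * 0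
  z-exponent = ℕ-solve-∀
  q-exponent : ∀ n k → n *ᶻ k ≡ 0ℤ +ᶻ k *ᶻ n
  q-exponent = solve-∀
  xⁿ≈zⁿyᵏ : X 1 (+ k) ^ n ≈ X n 0ℤ ⊗ X 0 (+ n) ^ k
  xⁿ≈zⁿyᵏ = begin
    X 1 (+ k) ^ n                    ≈⟨ X-^ 1 (+ k) n ⟩
    X (n * 1) (+ n *ᶻ + k)           ≈⟨ X-≡ (z-exponent n k) (q-exponent (+ n) (+ k)) ⟩
    X n 0ℤ ⊗ X (k * 0) (+ k *ᶻ + n)  ≈⟨ ⊗-congʳ (X n 0ℤ) (X-^ 0 (+ n) k) ⟨
    X n 0ℤ ⊗ X 0 (+ n) ^ k           ∎
zⁿ≡1-mod -[1+ k ] n x≡1 y≡1 = ≡1-mod-resp-≈ yᵏ⁺¹xⁿ≈zⁿ (≡1-mod-* (≡1-mod-^ y≡1 (suc k)) (≡1-mod-^ x≡1 n))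
  where
  z-exponent : ∀ k n → suc k * 0 ℕ.+ n * 1 ≡ n
  z-exponent = ℕ-solve-∀
  q-exponent : ∀ k n → k *ᶻ n +ᶻ n *ᶻ - k ≡ 0ℤ
  q-exponent = solve-∀
  yᵏ⁺¹xⁿ≈zⁿ : X 0 (+ n) ^ suc k ⊗ X 1 -[1+ k ] ^ n ≈ X n 0ℤ
  yᵏ⁺¹xⁿ≈zⁿ = begin
    X 0 (+ n) ^ suc k ⊗ X 1 -[1+ k ] ^ n
      ≈⟨ ⊗-cong (X-^ 0 (+ n) (suc k)) (X-^ 1 -[1+ k ] n) ⟩
    X (suc k * 0 ℕ.+ n * 1) (+ suc k *ᶻ + n +ᶻ + n *ᶻ -[1+ k ])
      ≈⟨ X-≡ (z-exponent k n) (q-exponent (+ suc k) (+ n)) ⟩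
    X n 0ℤ
      ∎

-- Modulo the ideal, q^e z ≡ 1 and q^n q^e z ≡ 1, hence q^n ≡ 1.
oneMinusZ-∈⟨⟩ : ∀ e n → oneMinusZ n ∈⟨ oneMinusQZ (e +ᶻ + n) Vector.∷ oneMinusQZ e Vector.∷ Vector.[] ⟩
oneMinusZ-∈⟨⟩ e n = ∈⟨⟩-resp-≈ (≈-sym (oneMinusZ≈ n)) (1-x∈⟨⟩ (zⁿ≡1-mod e n x≡1 (≡1-mod-cancelʳ yx≡1 x≡1)))
  where
  g : Vector.Vector Poly 2
  g = oneMinusQZ (e +ᶻ + n) Vector.∷ oneMinusQZ e Vector.∷ Vector.[]
  x≡1 : X 1 e ≡1-mod⟨ g ⟩
  x≡1 = ≡1-mod (∈⟨⟩-resp-≈ (oneMinusQZ≈ e) (∈⟨⟩-generator (suc zero)))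
  yx≡1 : X 0 (+ n) ⊗ X 1 e ≡1-mod⟨ g ⟩
  yx≡1 = ≡1-mod-resp-≈ (X-≡ refl (ℤP.+-comm e (+ n)))
                       (≡1-mod (∈⟨⟩-resp-≈ (oneMinusQZ≈ (e +ᶻ + n)) (∈⟨⟩-generator zero)))

-- The products d_{r,ℓ} and d_{r,ℓ} / L_i

L : ℤ → ℕ → Poly
L r j = oneMinusQZ (r +ᶻ + (2 * j))

D : ℤ → (ℓ : ℕ) → Vector.Vector Poly (suc ℓ)
D r ℓ i = dDiv r ℓ (toℕ i)

sumP-tabulate : ∀ {n} (F : Vector.Vector Poly n) → sumP (tabulate F) ≡ sum F
sumP-tabulate {zero}  F = refl
sumP-tabulate {suc n} F = cong (F zero ⊕_) (sumP-tabulate (F ∘ suc))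

lhs≡sum : ∀ r ℓ p → lhs r ℓ p ≡ sum (λ i → p i ⊗ D r ℓ i)
lhs≡sum r ℓ p = ≡.trans (cong sumP (ListP.map-tabulate id F)) (sumP-tabulate F)
  where
  F : Vector.Vector Poly (suc ℓ)
  F i = p i ⊗ D r ℓ i

prodP-++ : ∀ ps rs → prodP (ps ++ rs) ≈ prodP ps ⊗ prodP rs
prodP-++ []       rs = ≈-sym (⊗-identityˡ (prodP rs))
prodP-++ (p ∷ ps) rs = ≈-trans (⊗-congʳ p (prodP-++ ps rs)) (≈-sym (⊗-assoc p (prodP ps) (prodP rs)))

L-suc : ∀ r j → L r (suc j) ≡ L (r +ᶻ + 2) j
L-suc r j = cong oneMinusQZ (≡.trans (cong (λ x → r +ᶻ + x) (ℕP.*-suc 2 j))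
  (≡.trans (cong (r +ᶻ_) (ℤP.pos-+ 2 (2 * j))) (≡.sym (ℤP.+-assoc r (+ 2) (+ (2 * j))))))

prodL-map-suc : ∀ r js → prodP (map (L r) (map suc js)) ≡ prodP (map (L (r +ᶻ + 2)) js)
prodL-map-suc r js = cong prodP (≡.trans (≡.sym (ListP.map-∘ js)) (ListP.map-cong (L-suc r) js))

upTo-suc : ∀ n → upTo (suc n) ≡ 0 ∷ map suc (upTo n)
upTo-suc n = cong (0 ∷_) (≡.sym (ListP.map-applyUpTo id suc n))

filter-≢-map-suc : ∀ k js → filter (λ j → ¬? (j ℕ.≟ suc k)) (map suc js)
                           ≡ map suc (filter (λ j → ¬? (j ℕ.≟ k)) js)
filter-≢-map-suc k []       = refl
filter-≢-map-suc k (j ∷ js) with j ℕ.≟ k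
... | yes refl = ≡.trans (ListP.filter-reject (λ i → ¬? (i ℕ.≟ suc k)) (λ ne → ne refl))
  (≡.trans (filter-≢-map-suc k js) (cong (map suc) (≡.sym (ListP.filter-reject (λ i → ¬? (i ℕ.≟ k)) (λ ne → ne refl)))))
... | no j≢k   = ≡.trans (ListP.filter-accept (λ i → ¬? (i ℕ.≟ suc k)) (j≢k ∘ ℕP.suc-injective))
  (≡.trans (cong (suc j ∷_) (filter-≢-map-suc k js)) (cong (map suc) (≡.sym (ListP.filter-accept (λ i → ¬? (i ℕ.≟ k)) j≢k))))

filter-≢0-map-suc : ∀ js → filter (λ j → ¬? (j ℕ.≟ 0)) (map suc js) ≡ map suc js
filter-≢0-map-suc []       = refl
filter-≢0-map-suc (j ∷ js) =
  ≡.trans (ListP.filter-accept (λ i → ¬? (i ℕ.≟ 0)) {xs = map suc js} λ ()) (cong (suc j ∷_) (filter-≢0-map-suc js))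

d-suc : ∀ r m → d r (suc m) ≡ L r 0 ⊗ d (r +ᶻ + 2) m
d-suc r m = ≡.trans (cong (prodP ∘ map (L r)) (upTo-suc (suc m))) (cong (L r 0 ⊗_) (prodL-map-suc r (upTo (suc m))))

dDiv-suc-zero : ∀ r m → dDiv r (suc m) 0 ≡ d (r +ᶻ + 2) m
dDiv-suc-zero r m = ≡.trans (cong (λ js → prodP (map (L r) (filter (λ j → ¬? (j ℕ.≟ 0)) js))) (upTo-suc (suc m)))
  (≡.trans (cong (prodP ∘ map (L r)) (filter-≢0-map-suc (upTo (suc m)))) (prodL-map-suc r (upTo (suc m))))

dDiv-suc-suc : ∀ r m k → dDiv r (suc m) (suc k) ≡ L r 0 ⊗ dDiv (r +ᶻ + 2) m k
dDiv-suc-suc r m k = ≡.trans (cong (λ js → prodP (map (L r) (filter (λ j → ¬? (j ℕ.≟ suc k)) js))) (upTo-suc (suc m)))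
  (cong (L r 0 ⊗_) (≡.trans (cong (prodP ∘ map (L r)) (filter-≢-map-suc k (upTo (suc m))))
                            (prodL-map-suc r (filter (λ j → ¬? (j ℕ.≟ k)) (upTo (suc m))))))

dDiv-suc-≢ : ∀ r m k → k ≢ suc m → dDiv r (suc m) k ≈ dDiv r m k ⊗ L r (suc m)
dDiv-suc-≢ r m k k≢1+m = begin
  Π (filter ≢k (upTo (suc (suc m))))                   ≡⟨ cong (Π ∘ filter ≢k) (ListP.applyUpTo-∷ʳ id (suc m)) ⟨
  Π (filter ≢k (js ++ [ suc m ]))                      ≡⟨ cong Π (ListP.filter-++ ≢k js [ suc m ]) ⟩
  Π (filter ≢k js ++ filter ≢k [ suc m ])              ≡⟨ cong (λ ks → Π (filter ≢k js ++ ks)) 1+m-kept ⟩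
  Π (filter ≢k js ++ [ suc m ])                        ≡⟨ cong prodP (ListP.map-++ (L r) (filter ≢k js) [ suc m ]) ⟩
  prodP (map (L r) (filter ≢k js) ++ [ L r (suc m) ])  ≈⟨ prodP-++ (map (L r) (filter ≢k js)) [ L r (suc m) ] ⟩
  dDiv r m k ⊗ (L r (suc m) ⊗ 1P)                      ≈⟨ ⊗-congʳ (dDiv r m k) (*-identityʳ (L r (suc m))) ⟩
  dDiv r m k ⊗ L r (suc m)                             ∎
  where
  ≢k = λ j → ¬? (j ℕ.≟ k)
  js = upTo (suc m)
  Π = prodP ∘ map (L r)
  1+m-kept = ListP.filter-accept ≢k {xs = []} (k≢1+m ∘ ≡.sym)

L⊗dDiv≈d : ∀ r ℓ k → k ≤ ℓ → L r k ⊗ dDiv r ℓ k ≈ d r ℓ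
L⊗dDiv≈d r zero    zero    _         = ≈-refl
L⊗dDiv≈d r (suc m) zero    _         = ≈-reflexive (≡.trans (cong (L r 0 ⊗_) (dDiv-suc-zero r m)) (≡.sym (d-suc r m)))
L⊗dDiv≈d r (suc m) (suc k) (s≤s k≤m) = begin
  L r (suc k) ⊗ dDiv r (suc m) (suc k)                 ≡⟨ cong₂ _⊗_ (L-suc r k) (dDiv-suc-suc r m k) ⟩
  L (r +ᶻ + 2) k ⊗ (L r 0 ⊗ dDiv (r +ᶻ + 2) m k)       ≈⟨ x∙yz≈y∙xz (L (r +ᶻ + 2) k) (L r 0) (dDiv (r +ᶻ + 2) m k) ⟩
  L r 0 ⊗ (L (r +ᶻ + 2) k ⊗ dDiv (r +ᶻ + 2) m k)       ≈⟨ ⊗-congʳ (L r 0) (L⊗dDiv≈d (r +ᶻ + 2) m k k≤m) ⟩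
  L r 0 ⊗ d (r +ᶻ + 2) m                               ≡⟨ d-suc r m ⟨
  d r (suc m)                                          ∎

punchIn-fromℕ : ∀ {n} (i : Fin n) → punchIn (fromℕ n) i ≡ inject₁ i
punchIn-fromℕ zero    = refl
punchIn-fromℕ (suc i) = cong suc (punchIn-fromℕ i)

D-removeAt-zero : ∀ r m i → Vector.removeAt (D r (suc m)) zero i ≈ L r 0 ⊗ D (r +ᶻ + 2) m i
D-removeAt-zero r m i = ≈-reflexive (dDiv-suc-suc r m (toℕ i))

D-removeAt-last : ∀ r m i → Vector.removeAt (D r (suc m)) (fromℕ (suc m)) i ≈ L r (suc m) ⊗ D r m i
D-removeAt-last r m i = begin
  dDiv r (suc m) (toℕ (punchIn (fromℕ (suc m)) i))   ≡⟨ cong (dDiv r (suc m) ∘ toℕ) (punchIn-fromℕ i) ⟩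
  dDiv r (suc m) (toℕ (inject₁ i))                   ≈⟨ dDiv-suc-≢ r m _ (FinP.toℕ-inject₁-≢ i ∘ ≡.sym) ⟩
  dDiv r m (toℕ (inject₁ i)) ⊗ L r (suc m)           ≡⟨ cong (λ k → dDiv r m k ⊗ L r (suc m)) (FinP.toℕ-inject₁ i) ⟩
  D r m i ⊗ L r (suc m)                              ≈⟨ ⊗-comm (D r m i) (L r (suc m)) ⟩
  L r (suc m) ⊗ D r m i                              ∎

rhs-suc : ∀ m → rhs (suc m) ≈ oneMinusZ (2 * suc m) ⊗ rhs m
rhs-suc m = begin
  prodP (map F (upTo (suc m)))          ≡⟨ cong (prodP ∘ map F) (ListP.applyUpTo-∷ʳ id m) ⟨
  prodP (map F (upTo m ++ [ m ]))       ≡⟨ cong prodP (ListP.map-++ F (upTo m) [ m ]) ⟩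
  prodP (map F (upTo m) ++ [ F m ])     ≈⟨ prodP-++ (map F (upTo m)) [ F m ] ⟩
  rhs m ⊗ (F m ⊗ 1P)                    ≈⟨ ⊗-congʳ (rhs m) (*-identityʳ (F m)) ⟩
  rhs m ⊗ F m                           ≈⟨ ⊗-comm (rhs m) (F m) ⟩
  F m ⊗ rhs m                           ∎
  where F = λ k → oneMinusZ (2 * suc k)

rhs-∈⟨D⟩ : ∀ ℓ r → rhs ℓ ∈⟨ D r ℓ ⟩
rhs-∈⟨D⟩ zero    r = ∈⟨⟩-generator zero
rhs-∈⟨D⟩ (suc m) r = ∈⟨⟩-resp-≈ (≈-sym (rhs-suc m)) (∈⟨⟩-*-generators (oneMinusZ-∈⟨⟩ r n) L⊗rhs-∈)
  where
  n = 2 * suc m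
  L⊗rhs-∈ : ∀ j → (oneMinusQZ (r +ᶻ + n) Vector.∷ oneMinusQZ r Vector.∷ Vector.[]) j ⊗ rhs m ∈⟨ D r (suc m) ⟩
  L⊗rhs-∈ zero       =
    ∈⟨⟩-removeAt (fromℕ (suc m)) (∈⟨⟩-scale {t = L r (suc m)} (D-removeAt-last r m) (rhs-∈⟨D⟩ m r))
  L⊗rhs-∈ (suc zero) = ∈⟨⟩-resp-≈ (≈-reflexive (cong (λ e → oneMinusQZ e ⊗ rhs m) (ℤP.+-identityʳ r)))
    (∈⟨⟩-removeAt zero (∈⟨⟩-scale {t = L r 0} (D-removeAt-zero r m) (rhs-∈⟨D⟩ m (r +ᶻ + 2))))

-- Nonzero coefficients

max : ∀ {n} → Vector.Vector ℕ n → ℕ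
max = Vector.foldr ℕ._⊔_ 0

≤-max : ∀ {n} (f : Vector.Vector ℕ n) i → f i ≤ max f
≤-max f zero    = ℕP.m≤m⊔n (f zero) _
≤-max f (suc i) = ℕP.≤-trans (≤-max (f ∘ suc) i) (ℕP.m≤n⊔m (f zero) _)

coeff-leading : ∀ c N e → coeff ([ mon c N 0ℤ ] ⊗ oneMinusQZ e) N 0ℤ ≡ c
coeff-leading c N e = ≡.trans (cong (λ p → coeff p N 0ℤ) (ListP.++-identityʳ (map (mulT (mon c N 0ℤ)) (oneMinusQZ e))))
  (≡.trans (coeff-map-mulT (mon c N 0ℤ) (oneMinusQZ e) N 0ℤ)
    (≡.trans (cong (c *ᶻ_) (shiftedCoeff-here (oneMinusQZ e) N 0ℤ)) (ℤP.*-identityʳ c)))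

weight : ∀ m → Vector.Vector ℤ (suc (suc m))
weight m zero    = - (+ suc m)
weight m (suc _) = 1ℤ

weight≢0 : ∀ m i → weight m i ≢ 0ℤ
weight≢0 m zero    ()
weight≢0 m (suc _) ()

sum-mon-1 : ∀ k a b → sum (λ (_ : Fin k) → [ mon 1ℤ a b ]) ≈ [ mon (+ k) a b ]
sum-mon-1 zero    a b = ≈-sym (mon-0 a b)
sum-mon-1 (suc k) a b = ≈-trans (⊕-cong (≈-refl {[ mon 1ℤ a b ]}) (sum-mon-1 k a b)) (mon-+ 1ℤ (+ k) a b)

sum-weight : ∀ m a b → sum (λ i → [ mon (weight m i) a b ]) ≈ 0P
sum-weight m a b = begin
  [ mon c₀ a b ] ⊕ sum (λ (_ : Fin (suc m)) → [ mon 1ℤ a b ])  ≈⟨ ⊕-cong (≈-refl {[ mon c₀ a b ]}) (sum-mon-1 (suc m) a b) ⟩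
  [ mon c₀ a b ] ⊕ [ mon (+ suc m) a b ]                       ≈⟨ mon-+ c₀ (+ suc m) a b ⟩
  [ mon (c₀ +ᶻ + suc m) a b ]                                  ≡⟨ cong (λ c → [ mon c a b ]) (ℤP.+-inverseˡ (+ suc m)) ⟩
  [ mon 0ℤ a b ]                                               ≈⟨ mon-0 a b ⟩
  0P                                                           ∎
  where c₀ = - (+ suc m)

nonzero-representation : ∀ r m {f} → f ∈⟨ D r (suc m) ⟩ →
                         Σ (f ∈⟨ D r (suc m) ⟩) λ f∈ → ∀ i → NonZeroP (coefficients f∈ i)
nonzero-representation r m {f} f∈@(combination a _) =
  ∈⟨⟩-resp-≈ (⊕-identityʳ f) (∈⟨⟩-+ f∈ (combination u Σu⊗D≈0)) , nonzero
  where
  N = suc (max (zdeg ∘ a))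
  zᴺ : ℤ → Poly
  zᴺ c = [ mon c N 0ℤ ]
  u : Vector.Vector Poly (suc (suc m))
  u i = zᴺ (weight m i) ⊗ L r (toℕ i)
  uD≈zᴺd : ∀ i → u i ⊗ D r (suc m) i ≈ zᴺ (weight m i) ⊗ d r (suc m)
  uD≈zᴺd i = ≈-trans (⊗-assoc (zᴺ (weight m i)) (L r (toℕ i)) (D r (suc m) i))
                     (⊗-congʳ (zᴺ (weight m i)) (L⊗dDiv≈d r (suc m) (toℕ i) (FinP.toℕ≤pred[n] i)))
  Σu⊗D≈0 : sum (λ i → u i ⊗ D r (suc m) i) ≈ 0P
  Σu⊗D≈0 = begin
    sum (λ i → u i ⊗ D r (suc m) i)             ≈⟨ sum-cong-≋ uD≈zᴺd ⟩
    sum (λ i → zᴺ (weight m i) ⊗ d r (suc m))   ≈⟨ *-distribʳ-sum (d r (suc m)) (zᴺ ∘ weight m) ⟨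
    sum (zᴺ ∘ weight m) ⊗ d r (suc m)           ≈⟨ ⊗-cong (sum-weight m N 0ℤ) (≈-refl {d r (suc m)}) ⟩
    0P                                          ∎
  nonzero : ∀ i → NonZeroP (a i ⊕ u i)
  nonzero i = N , 0ℤ , λ coeff≡0 → weight≢0 m i (≡.trans (≡.sym leading) coeff≡0)
    where
    leading : coeff (a i ⊕ u i) N 0ℤ ≡ weight m i
    leading = ≡.trans (coeff-++ (a i) (u i) N 0ℤ)
      (≡.trans (cong₂ _+ᶻ_ (coeff-zdeg< (a i) 0ℤ (s≤s (≤-max (zdeg ∘ a) i)))
                           (coeff-leading (weight m i) N (r +ᶻ + (2 * toℕ i))))
               (ℤP.+-identityˡ (weight m i)))

proposition4p4 : (r : ℤ) (ℓ : ℕ) →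
    (∀ (i : ℕ) → i ≤ ℓ → r ≢ - (+ (2 * i))) →
    Σ (Fin (suc ℓ) → Poly) λ p →
      (∀ i → NonZeroP (p i)) × (lhs r ℓ p ≈P rhs ℓ)
proposition4p4 r zero    _ = (λ _ → 1P) , (λ _ → 0 , 0ℤ , λ ()) , λ _ _ → refl
proposition4p4 r (suc m) _ =
  let (combination p Σp⊗D≈rhs , p≢0) = nonzero-representation r m (rhs-∈⟨D⟩ (suc m) r)
  in p , p≢0 , coeff-≡ (≈-trans (≈-reflexive (lhs≡sum r (suc m) p)) Σp⊗D≈rhs)
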